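{- Let $L$ be a complete lattice with a unary operation $-$ that is anti-monotone and involutive, such that $L$ has down-distribution, let $F$ be a set of designated values in $L$, and let implication be $x\supset y=-x+y$. Then $F$ is implicative in $L$ if and only if every Kripke frame $\mathcal{F}=\langle W,R\rangle$ satisfies $\mathcal{F}\Vdash_{L,F}\Box(\varphi\to\psi)\to(\Box\varphi\to\Box\psi)$ for all formulas $\varphi,\psi$.
   Context: $+$ and $.$ are join and meet; $\bigwedge S$ is the greatest lower bound of $S$. $-$ is anti-monotone if $a\le b$ implies $-b\le -a$, and involutive if $--a=a$ for all $a$. For $A,B\subseteq L$, $A+B=\{a+b\mid a\in A,b\in B\}$; $L$ has down-distribution if $\bigwedge(A+B)=\bigwedge A+\bigwedge B$ for all $A,B\subseteq L$. A set of designated values is an upward closed subset $F\subseteq L$; $F$ is implicative if $a\le b$ implies $a\supset b\in F$. Formulas use $\land,\lor,\lnot,\to,\Box$. A normal modal valuation on a frame $\langle W,R\rangle$ is $v:W\times\mathrm{Form}\to L$ (write $v_w$) with $v_w(\varphi\lor\psi)=v_w(\varphi)+v_w(\psi)$, $v_w(\varphi\land\psi)=v_w(\varphi).v_w(\psi)$, $v_w(\lnot\varphi)=-v_w(\varphi)$, $v_w(\varphi\to\psi)=-v_w(\varphi)+v_w(\psi)$, $v_w(\Box\varphi)=\bigwedge\{v_{w'}(\varphi)\mid wRw'\}$, variables arbitrary. An $L$-model is $\langle W,R,v\rangle$ with such $v$; $w\Vdash_{L,F}\varphi$ iff $v_w(\varphi)\in F$; a frame satisfies $\varphi$ if every world of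 every $L$-model on it does. -}

module Defs where

open import Level using (Level; suc; _⊔_)
open import Data.Nat using (ℕ)
open import Data.Product using (Σ; ∃; _×_; _,_)
open import Relation.Unary using (Pred; _∈_)
open import Relation.Binary using (Rel)
open import Relation.Binary.Lattice.Bundles using (Lattice)

-- A complete lattice: a lattice (order ≤, join ∨ = "+", meet ∧ = ".")
-- together with greatest lower bounds ⋀ S of arbitrary subsets S.
record CompleteLattice (a : Level) : Set (suc a) where
  field
    lattice : Lattice a a a
  open Lattice lattice public
  field
    ⋀          : Pred Carrier a → Carrier
    ⋀-lower    : ∀ (S : Pred Carrier a) x → x ∈ S → ⋀ S ≤ x
    ⋀-greatest : ∀ (S : Pred Carrier a) y → (∀ x → x ∈ S → y ≤ x) → y ≤ ⋀ S

module _ {a : Level} (L : CompleteLattice a) where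
  open CompleteLattice L

  AntiMonotone : (Carrier → Carrier) → Set a
  AntiMonotone neg = ∀ x y → x ≤ y → neg y ≤ neg x

  Involutive : (Carrier → Carrier) → Set a
  Involutive neg = ∀ x → neg (neg x) ≈ x

  _⊕_ : Pred Carrier a → Pred Carrier a → Pred Carrier a
  (A ⊕ B) x = Σ Carrier λ y → Σ Carrier λ z → y ∈ A × z ∈ B × x ≈ (y ∨ z)

  DownDistribution : Set (suc a)
  DownDistribution = ∀ (A B : Pred Carrier a) → ⋀ (A ⊕ B) ≈ (⋀ A ∨ ⋀ B)

  UpwardClosed : Pred Carrier a → Set a
  UpwardClosed F = ∀ x y → x ∈ F → x ≤ y → y ∈ F

  _⊃[_]_ : Carrier → (Carrier → Carrier) → Carrier → Carrier
  x ⊃[ neg ] y = neg x ∨ y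

  Implicative : (Carrier → Carrier) → Pred Carrier a → Set a
  Implicative neg F = ∀ x y → x ≤ y → (x ⊃[ neg ] y) ∈ F

data Form : Set where
  var  : ℕ → Form
  _∧'_ : Form → Form → Form
  _∨'_ : Form → Form → Form
  ¬'_  : Form → Form
  _⇒_  : Form → Form → Form
  □_   : Form → Form

infixr 5 _⇒_
infix 8 □_

module _ {a : Level} (L : CompleteLattice a) (neg : CompleteLattice.Carrier L → CompleteLattice.Carrier L) where
  open CompleteLattice L

  val : (W : Set a) (R : Rel W a) (V : W → ℕ → Carrier) → W → Form → Carrier
  val W R V w (var n)   = V w n
  val W R V w (φ ∧' ψ)  = val W R V w φ ∧ val W R V w ψ
  val W R V w (φ ∨' ψ)  = val W R V w φ ∨ val W R V w ψ
  val W R V w (¬' φ)    = neg (val W R V w φ)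
  val W R V w (φ ⇒ ψ)   = neg (val W R V w φ) ∨ val W R V w ψ
  val W R V w (□ φ)     = ⋀ (λ x → Σ W λ w' → R w w' × val W R V w' φ ≈ x)

  Forces : (F : Pred Carrier a) (W : Set a) (R : Rel W a) (V : W → ℕ → Carrier) → W → Form → Set a
  Forces F W R V w φ = val W R V w φ ∈ F

  FrameSat : (F : Pred Carrier a) (W : Set a) (R : Rel W a) → Form → Set a
  FrameSat F W R φ = ∀ (V : W → ℕ → Carrier) (w : W) → Forces F W R V w φ

{-# OPTIONS --safe #-}
module Submission where

-- Soundness: with f, g the values of φ, ψ at the successors of a world, □(φ ⇒ ψ) is the
-- meet of the -f i + g i, each above -⋀f + g i, and down-distribution makes the meet of
-- the -⋀f + g i equal to -⋀f + ⋀g, the value of □φ ⇒ □ψ.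
-- Completeness: on a one-world reflexive frame with every variable valued x, the value
-- of K is at most -x + x, so x ⊃ x is designated, and x ⊃ x ≤ x ⊃ y when x ≤ y.

open import Defs
open import Level using (Level; Lift; lift)
open import Data.Product using (Σ; _×_; _,_)
open import Data.Unit using (⊤; tt)
open import Function.Bundles using (_⇔_; mk⇔)
open import Relation.Binary using (Rel)
open import Relation.Binary.PropositionalEquality using () renaming (refl to ≡-refl)
open import Relation.Unary using (Pred; _∈_; ｛_｝)
import Relation.Binary.Lattice.Properties.JoinSemilattice as JoinSemilatticeProperties

module _ {a : Level} (L : CompleteLattice a) where
  open CompleteLattice L
  open JoinSemilatticeProperties joinSemilattice using (∨-monotonic)

  Image : {I : Set a} → Pred I a → (I → Carrier) → Pred Carrier a
  Image {I} P f x = Σ I λ i → P i × f i ≈ x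

  ⋀over : {I : Set a} → Pred I a → (I → Carrier) → Carrier
  ⋀over P f = ⋀ (Image P f)

  ⋀over-lower : ∀ {I : Set a} (P : Pred I a) (f : I → Carrier) {i} → P i → ⋀over P f ≤ f i
  ⋀over-lower P f {i} p = ⋀-lower (Image P f) (f i) (i , p , Eq.refl)

  ⋀over-greatest : ∀ {I : Set a} (P : Pred I a) (f : I → Carrier) {y}
                 → (∀ i → P i → y ≤ f i) → y ≤ ⋀over P f
  ⋀over-greatest P f {y} y≤f =
    ⋀-greatest (Image P f) y λ { x (i , p , fi≈x) → trans (y≤f i p) (reflexive fi≈x) }

  ⋀[x⊕S]≤x∨⋀S : DownDistribution L → ∀ x (S : Pred Carrier a) → ⋀ (_⊕_ L ｛ x ｝ S) ≤ x ∨ ⋀ S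
  ⋀[x⊕S]≤x∨⋀S dd x S = trans (reflexive (dd ｛ x ｝ S)) (∨-monotonic (⋀-lower ｛ x ｝ x ≡-refl) refl)

  module _ (neg : Carrier → Carrier) where
    private
      _⊃_ : Carrier → Carrier → Carrier
      x ⊃ y = _⊃[_]_ L x neg y

    ⋀[f⊃g]≤⋀f⊃⋀g : AntiMonotone L neg → DownDistribution L
                 → ∀ {I : Set a} (P : Pred I a) (f g : I → Carrier)
                 → ⋀over P (λ i → f i ⊃ g i) ≤ (⋀over P f ⊃ ⋀over P g)
    ⋀[f⊃g]≤⋀f⊃⋀g anti dd P f g =
      trans (⋀-greatest (_⊕_ L ｛ c ｝ (Image P g)) _ below) (⋀[x⊕S]≤x∨⋀S dd c (Image P g))
      where
      c : Carrier
      c = neg (⋀over P f)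
      below : ∀ z → z ∈ _⊕_ L ｛ c ｝ (Image P g) → ⋀over P (λ i → f i ⊃ g i) ≤ z
      below z (_ , s , ≡-refl , (i , p , gi≈s) , z≈c∨s) =
        trans (⋀over-lower P (λ i → f i ⊃ g i) p)
          (trans (∨-monotonic (anti _ _ (⋀over-lower P f p)) (reflexive gi≈s))
                 (reflexive (Eq.sym z≈c∨s)))

    Implicative-if-⊃-refl : (F : Pred Carrier a) → UpwardClosed L F
                          → (∀ x → (x ⊃ x) ∈ F) → Implicative L neg F
    Implicative-if-⊃-refl F up x⊃x∈F x y x≤y = up (x ⊃ x) (x ⊃ y) (x⊃x∈F x) (∨-monotonic refl x≤y)

    K-sound : AntiMonotone L neg → DownDistribution L
            → (F : Pred Carrier a) → Implicative L neg F
            → ∀ (W : Set a) (R : Rel W a) (φ ψ : Form)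
            → FrameSat L neg F W R (□ (φ ⇒ ψ) ⇒ (□ φ ⇒ □ ψ))
    K-sound anti dd F imp W R φ ψ V w =
      imp _ _ (⋀[f⊃g]≤⋀f⊃⋀g anti dd (R w) (λ w' → v w' φ) (λ w' → v w' ψ))
      where
      v = val L neg W R V

    K-at-constant-valuation≤x⊃x : AntiMonotone L neg
      → ∀ (W : Set a) (R : Rel W a) {w w'} → R w w' → ∀ x
      → val L neg W R (λ _ _ → x) w (□ (var 0 ⇒ var 0) ⇒ (□ var 0 ⇒ □ var 0)) ≤ (x ⊃ x)
    K-at-constant-valuation≤x⊃x anti W R {w} Rww' x =
      ∨-least (trans (anti _ _ x≤□[x⊃x]) (x≤x∨y _ _))
              (∨-least (trans (anti _ _ x≤□x) (x≤x∨y _ _))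
                       (trans (⋀over-lower (R w) (λ _ → x) Rww') (y≤x∨y _ _)))
      where
      x≤□[x⊃x] : x ≤ ⋀over (R w) (λ _ → x ⊃ x)
      x≤□[x⊃x] = ⋀over-greatest (R w) (λ _ → x ⊃ x) λ _ _ → y≤x∨y _ _
      x≤□x : x ≤ ⋀over (R w) (λ _ → x)
      x≤□x = ⋀over-greatest (R w) (λ _ → x) λ _ _ → refl

    ⊃-refl-if-K-valid : AntiMonotone L neg → (F : Pred Carrier a) → UpwardClosed L F
      → (∀ (W : Set a) (R : Rel W a) (φ ψ : Form) → FrameSat L neg F W R (□ (φ ⇒ ψ) ⇒ (□ φ ⇒ □ ψ)))
      → ∀ x → (x ⊃ x) ∈ F
    ⊃-refl-if-K-valid anti F up K-valid x =
      up _ _ (K-valid W R (var 0) (var 0) (λ _ _ → x) (lift tt))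
             (K-at-constant-valuation≤x⊃x anti W R (lift tt) x)
      where
      W : Set a
      W = Lift a ⊤
      R : Rel W a
      R _ _ = Lift a ⊤

-- The involutivity hypothesis is deliberately unused: neither direction needs it.
mainTheorem10 : {a : Level} (L : CompleteLattice a)
    (neg : CompleteLattice.Carrier L → CompleteLattice.Carrier L)
    → AntiMonotone L neg → Involutive L neg → DownDistribution L
    → (F : Pred (CompleteLattice.Carrier L) a) → UpwardClosed L F
    → Implicative L neg F
      ⇔ (∀ (W : Set a) (R : Rel W a) (φ ψ : Form)
           → FrameSat L neg F W R (□ (φ ⇒ ψ) ⇒ (□ φ ⇒ □ ψ)))
mainTheorem10 L neg anti _ dd F up =
  mk⇔ (K-sound L neg anti dd F)
      (λ K-valid → Implicative-if-⊃-refl L neg F up (⊃-refl-if-K-valid L neg anti F up K-valid))
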